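{- Let $l\geq 3$ be an integer, let $H$ be a $3$-uniform hypergraph containing no $3$-uniform loose cycle of length $l$, and let $(X,Y)$ be an extender in $H$. Then for any distinct $u,v\in X$ there is no simple path of length $l-2$ in the induced hypergraph $(H+H^*)[V(H)\setminus Y]$ joining $u$ to $v$.
   Context: A loose cycle of length $l$ is a hypergraph with $l$ edges $e_1,\dots,e_l$ such that $|e_i\cap e_j|=1$ whenever $j\equiv i\pm1 \pmod l$ and $e_i\cap e_j=\emptyset$ otherwise. A path of length $k$ is a hypergraph with edges $e_1,\dots,e_k$, each of size at least 2, such that for $i<j$, $e_i\cap e_j=\emptyset$ unless $j=i+1$, in which case $e_i\cap e_{i+1}\neq\emptyset$. A hypergraph is simple if distinct edges share at most one vertex. A simple path $P$ of length $k$ joins $a$ to $b$ if $a\in e_1\setminus e_2$ and $b\in e_k\setminus e_{k-1}$. For $X\subseteq V(H)$, $H[X]$ is the hypergraph on $X$ whose edges are the edges of $H$ contained in $X$. Light/heavy (depending on $l$): a pair of vertices is heavy in $H$ if it lies in at least $2l-2$ edges of $H$, light otherwise; an edge is light if it contains no heavy pair. $H^*$ has vertex set $V(H)$ and edges the light edges of $H$ together with all heavy pairs (as 2-element edges). $H+H^*$ has vertex set $V(H)$ and edge set $E(H)\cup E(H^*)$. An extender in $H$ is a pair $(X,Y)$ of disjoint subsets of $V(H)$ such that (1) for any distinct $u,v\in X$ and any set $S\subseteq V(H)\setminus(\{u,v\}\cup Y)$ with $|S|\leq 2l-5$, there is a simple path of length two in $H$ joining $u$ to $v$ containing no element of $S$;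 and (2) $|Y|\leq 2|X|$. -}

module Defs where

open import Data.Nat using (ℕ; zero; suc; _+_; _*_; _∸_; _≤_; _<_)
open import Data.Fin using (Fin; toℕ)
open import Data.Fin.Subset using (Subset; _∈_; _∉_; _∩_; _∪_; ⁅_⁆; ∣_∣; ⊥; ∁; Nonempty; _⊆_)
open import Data.Fin.Subset.Properties using (_∈?_)
open import Data.List using (List; length; filter)
import Data.List.Membership.Propositional as LM
open import Data.Product using (Σ; ∃; _×_; _,_)
open import Data.Sum using (_⊎_)
open import Relation.Binary.PropositionalEquality using (_≡_; _≢_)
open import Relation.Nullary using (¬_)
open import Relation.Nullary.Decidable using (_×-dec_)

EdgeSet : ℕ → Set₁
EdgeSet n = Subset n → Set

-- The edge set of a hypergraph given by a (duplicate-free) list of edges.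
edgesOf : ∀ {n} → List (Subset n) → EdgeSet n
edgesOf E e = e LM.∈ E

codeg : ∀ {n} → List (Subset n) → Fin n → Fin n → ℕ
codeg E x y = length (filter (λ e → (x ∈? e) ×-dec (y ∈? e)) E)

Heavy : ∀ {n} → ℕ → List (Subset n) → Fin n → Fin n → Set
Heavy l E x y = x ≢ y × (2 * l ∸ 2 ≤ codeg E x y)

LightEdge : ∀ {n} → ℕ → List (Subset n) → Subset n → Set
LightEdge l E e = e LM.∈ E × (∀ x y → x ∈ e → y ∈ e → ¬ Heavy l E x y)

StarEdges : ∀ {n} → ℕ → List (Subset n) → EdgeSet n
StarEdges l E e = LightEdge l E e ⊎ (∃ λ x → ∃ λ y → Heavy l E x y × e ≡ ⁅ x ⁆ ∪ ⁅ y ⁆)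

PlusStar : ∀ {n} → ℕ → List (Subset n) → EdgeSet n
PlusStar l E e = e LM.∈ E ⊎ StarEdges l E e

Induced : ∀ {n} → EdgeSet n → Subset n → EdgeSet n
Induced G X e = G e × e ⊆ X

CycAdj : ∀ {l} → Fin l → Fin l → Set
CycAdj {l} i j =
  toℕ j ≡ suc (toℕ i) ⊎ toℕ i ≡ suc (toℕ j)
  ⊎ (toℕ i ≡ 0 × suc (toℕ j) ≡ l) ⊎ (toℕ j ≡ 0 × suc (toℕ i) ≡ l)

IsLooseCycle : ∀ {n} → EdgeSet n → (l : ℕ) → (Fin l → Subset n) → Set
IsLooseCycle G l f =
  (∀ i → G (f i)) ×
  (∀ i j → i ≢ j →
     (CycAdj i j → ∣ f i ∩ f j ∣ ≡ 1) × (¬ CycAdj i j → f i ∩ f j ≡ ⊥))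

HasLooseCycle : ∀ {n} → EdgeSet n → ℕ → Set
HasLooseCycle G l = ∃ λ (f : Fin l → Subset _) → IsLooseCycle G l f

IsPath : ∀ {n} → EdgeSet n → (k : ℕ) → (Fin k → Subset n) → Set
IsPath G k f =
  (∀ i → G (f i)) × (∀ i → 2 ≤ ∣ f i ∣) ×
  (∀ i j → toℕ i < toℕ j →
     (toℕ j ≡ suc (toℕ i) → Nonempty (f i ∩ f j)) ×
     (toℕ j ≢ suc (toℕ i) → f i ∩ f j ≡ ⊥))

IsSimple : ∀ {n k} → (Fin k → Subset n) → Set
IsSimple f = ∀ i j → i ≢ j → ∣ f i ∩ f j ∣ ≤ 1

-- a ∈ e_1 \ e_2 and b ∈ e_k \ e_{k-1}  (e_1 = f 0, e_k = f (k-1))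
Joins : ∀ {n k} → (Fin k → Subset n) → Fin n → Fin n → Set
Joins {k = k} f a b =
  (∀ i → toℕ i ≡ 0 → a ∈ f i) × (∀ i → toℕ i ≡ 1 → a ∉ f i) ×
  (∀ i → suc (toℕ i) ≡ k → b ∈ f i) × (∀ i → suc (suc (toℕ i)) ≡ k → b ∉ f i)

SimplePathJoining : ∀ {n} → EdgeSet n → ℕ → Fin n → Fin n → Set
SimplePathJoining {n} G k a b =
  ∃ λ (f : Fin k → Subset n) → IsPath G k f × IsSimple f × Joins f a b

IsExtender : ∀ {n} → ℕ → List (Subset n) → Subset n → Subset n → Set
IsExtender {n} l E X Y =
  (∀ x → x ∈ X → x ∉ Y) ×
  (∀ u v → u ∈ X → v ∈ X → u ≢ v →
     ∀ (S : Subset n) → (∀ x → x ∈ S → x ≢ u × x ≢ v × x ∉ Y) → ∣ S ∣ ≤ 2 * l ∸ 5 →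
       ∃ λ (f : Fin 2 → Subset n) →
         IsPath (edgesOf E) 2 f × IsSimple f × Joins f u v ×
         (∀ i x → x ∈ f i → x ∉ S)) ×
  (∣ Y ∣ ≤ 2 * ∣ X ∣)

-- Let e₁ … e_{l-2} be a simple path from u to v in (H + H*)[V ∖ Y].  Its edges have at most
-- three vertices and consecutive ones meet, so it spans at most 2l − 3 vertices and its interior S
-- (all of them but u and v) has at most 2l − 5.  The extender then yields a path g₀ g₁ of H from
-- u to v avoiding S ∪ Y, and e₁, …, e_{l-2}, g₁, g₀ meet exactly as the edges of a loose cycle of
-- length l.  Each of these is an edge of H or a heavy pair {x, y}.  The edges of H through a heavy
-- pair are at least 2l − 2 triples with pairwise distinct third vertices, while the cycle spans at
-- most 2l − 1 vertices, x and y among them; so one such edge {x, y, z} has z outside the cycle, and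
-- replacing {x, y} by it preserves all intersections.  Doing this for every heavy pair gives a loose
-- cycle of length l in H.

module Submission where

open import Defs
open import Data.Bool using (true; false)
open import Data.Vec using ([]; _∷_; here; there)
open import Data.Empty using (⊥-elim)
open import Data.Fin using (Fin; zero; suc; toℕ; fromℕ<)
open import Data.Fin.Properties using (any?; toℕ<n; toℕ-injective; toℕ-fromℕ<)
open import Data.Fin.Subset
open import Data.Fin.Subset.Properties
open import Data.Nat using (ℕ; zero; suc; _+_; _*_; _∸_; _≤_; _<_; s≤s; z≤n)
open import Data.Nat.Properties
open import Data.Nat.Tactic.RingSolver using (solve-∀)
open import Data.List using (List; []; _∷_; length; filter)
open import Data.List.Membership.Propositional using (find) renaming (_∈_ to _∈ₗ_)
open import Data.List.Membership.Propositional.Properties using (∈-filter⁻)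
open import Data.List.Relation.Unary.All as All using (All; []; _∷_; all?)
open import Data.List.Relation.Unary.All.Properties as AllP using (¬All⇒Any¬; all-filter)
open import Data.List.Relation.Unary.AllPairs using (_∷_)
open import Data.List.Relation.Unary.Unique.Propositional using (Unique)
open import Data.List.Relation.Unary.Unique.Propositional.Properties using (filter⁺)
open import Data.Product using (∃; _×_; _,_; proj₁; proj₂)
open import Data.Sum using (_⊎_; inj₁; inj₂)
open import Relation.Nullary using (¬_; yes; no; contradiction)
open import Relation.Nullary.Decidable using (_×-dec_; ¬?)
open import Relation.Binary using (tri<; tri≈; tri>)
open import Relation.Binary.PropositionalEquality

private variable
  n m : ℕ
  A : Set
  x y : Fin n
  p q : Subset n

-- Finite sets

∩-≡⊥ : (∀ {z} → z ∈ p → z ∉ q) → p ∩ q ≡ ⊥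
∩-≡⊥ {p = p} {q} disjoint = Empty-unique λ (z , z∈) → let z∈p , z∈q = x∈p∩q⁻ p q z∈ in disjoint z∈p z∈q

∩≡⊥⇒x∈p⇒x∉q : p ∩ q ≡ ⊥ → x ∈ p → x ∉ q
∩≡⊥⇒x∈p⇒x∉q {p = p} {q} p∩q≡⊥ x∈p x∈q = ∉⊥ (subst (_ ∈_) p∩q≡⊥ (x∈p∩q⁺ (x∈p , x∈q)))

∣p∪q∣+∣p∩q∣≡∣p∣+∣q∣ : (p q : Subset n) → ∣ p ∪ q ∣ + ∣ p ∩ q ∣ ≡ ∣ p ∣ + ∣ q ∣
∣p∪q∣+∣p∩q∣≡∣p∣+∣q∣ [] [] = refl
∣p∪q∣+∣p∩q∣≡∣p∣+∣q∣ (true ∷ p) (true ∷ q) = cong suc (begin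
  ∣ p ∪ q ∣ + suc ∣ p ∩ q ∣ ≡⟨ +-suc _ _ ⟩
  suc (∣ p ∪ q ∣ + ∣ p ∩ q ∣) ≡⟨ cong suc (∣p∪q∣+∣p∩q∣≡∣p∣+∣q∣ p q) ⟩
  suc (∣ p ∣ + ∣ q ∣) ≡⟨ +-suc _ _ ⟨
  ∣ p ∣ + suc ∣ q ∣ ∎)
  where open ≡-Reasoning
∣p∪q∣+∣p∩q∣≡∣p∣+∣q∣ (true ∷ p) (false ∷ q) = cong suc (∣p∪q∣+∣p∩q∣≡∣p∣+∣q∣ p q)
∣p∪q∣+∣p∩q∣≡∣p∣+∣q∣ (false ∷ p) (true ∷ q) =
  trans (cong suc (∣p∪q∣+∣p∩q∣≡∣p∣+∣q∣ p q)) (sym (+-suc _ _))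
∣p∪q∣+∣p∩q∣≡∣p∣+∣q∣ (false ∷ p) (false ∷ q) = ∣p∪q∣+∣p∩q∣≡∣p∣+∣q∣ p q

k≤∣p∩q∣⇒∣p∪q∣+k≤∣p∣+∣q∣ : (p q : Subset n) {k : ℕ} → k ≤ ∣ p ∩ q ∣ → ∣ p ∪ q ∣ + k ≤ ∣ p ∣ + ∣ q ∣
k≤∣p∩q∣⇒∣p∪q∣+k≤∣p∣+∣q∣ p q k≤ =
  ≤-trans (+-monoʳ-≤ ∣ p ∪ q ∣ k≤) (≤-reflexive (∣p∪q∣+∣p∩q∣≡∣p∣+∣q∣ p q))

∣p─q∣+∣p∩q∣≡∣p∣ : (p q : Subset n) → ∣ p ─ q ∣ + ∣ p ∩ q ∣ ≡ ∣ p ∣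
∣p─q∣+∣p∩q∣≡∣p∣ [] [] = refl
∣p─q∣+∣p∩q∣≡∣p∣ (true ∷ p) (true ∷ q) = trans (+-suc _ _) (cong suc (∣p─q∣+∣p∩q∣≡∣p∣ p q))
∣p─q∣+∣p∩q∣≡∣p∣ (true ∷ p) (false ∷ q) = cong suc (∣p─q∣+∣p∩q∣≡∣p∣ p q)
∣p─q∣+∣p∩q∣≡∣p∣ (false ∷ p) (true ∷ q) = ∣p─q∣+∣p∩q∣≡∣p∣ p q
∣p─q∣+∣p∩q∣≡∣p∣ (false ∷ p) (false ∷ q) = ∣p─q∣+∣p∩q∣≡∣p∣ p q

x∈p⇒⁅x⁆⊆p : x ∈ p → ⁅ x ⁆ ⊆ p
x∈p⇒⁅x⁆⊆p {x = x} {p} x∈p y∈⁅x⁆ = subst (_∈ p) (sym (x∈⁅y⁆⇒x≡y x y∈⁅x⁆)) x∈p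

p⊆q⇒x∈q⇒p∪⁅x⁆⊆q : p ⊆ q → x ∈ q → p ∪ ⁅ x ⁆ ⊆ q
p⊆q⇒x∈q⇒p∪⁅x⁆⊆q {p = p} p⊆q x∈q y∈ with x∈p∪q⁻ p _ y∈
... | inj₁ y∈p = p⊆q y∈p
... | inj₂ y∈⁅x⁆ = x∈p⇒⁅x⁆⊆p x∈q y∈⁅x⁆

x∈p⇒0<∣p∣ : x ∈ p → 0 < ∣ p ∣
x∈p⇒0<∣p∣ {x = x} x∈p = subst (_≤ _) (∣⁅x⁆∣≡1 x) (p⊆q⇒∣p∣≤∣q∣ (x∈p⇒⁅x⁆⊆p x∈p))

x∉p⇒∣p∪⁅x⁆∣≡1+∣p∣ : x ∉ p → ∣ p ∪ ⁅ x ⁆ ∣ ≡ suc ∣ p ∣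
x∉p⇒∣p∪⁅x⁆∣≡1+∣p∣ {n} {x} {p} x∉p = begin
  ∣ p ∪ ⁅ x ⁆ ∣               ≡⟨ +-identityʳ _ ⟨
  ∣ p ∪ ⁅ x ⁆ ∣ + 0           ≡⟨ cong (∣ p ∪ ⁅ x ⁆ ∣ +_) (trans (cong ∣_∣ p∩⁅x⁆≡⊥) (∣⊥∣≡0 n)) ⟨
  ∣ p ∪ ⁅ x ⁆ ∣ + ∣ p ∩ ⁅ x ⁆ ∣ ≡⟨ ∣p∪q∣+∣p∩q∣≡∣p∣+∣q∣ p ⁅ x ⁆ ⟩
  ∣ p ∣ + ∣ ⁅ x ⁆ ∣           ≡⟨ cong (∣ p ∣ +_) (∣⁅x⁆∣≡1 x) ⟩
  ∣ p ∣ + 1                   ≡⟨ +-comm _ 1 ⟩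
  suc ∣ p ∣                   ∎
  where
  open ≡-Reasoning
  p∩⁅x⁆≡⊥ : p ∩ ⁅ x ⁆ ≡ ⊥
  p∩⁅x⁆≡⊥ = ∩-≡⊥ λ y∈p y∈⁅x⁆ → x∉p (subst (_∈ p) (x∈⁅y⁆⇒x≡y x y∈⁅x⁆) y∈p)

∣⁅x⁆∪⁅y⁆∣≡2 : x ≢ y → ∣ ⁅ x ⁆ ∪ ⁅ y ⁆ ∣ ≡ 2
∣⁅x⁆∪⁅y⁆∣≡2 {x = x} {y} x≢y =
  trans (x∉p⇒∣p∪⁅x⁆∣≡1+∣p∣ (λ y∈⁅x⁆ → x≢y (sym (x∈⁅y⁆⇒x≡y x y∈⁅x⁆)))) (cong suc (∣⁅x⁆∣≡1 x))

⁅x⁆∪⁅y⁆⊆p : x ∈ p → y ∈ p → ⁅ x ⁆ ∪ ⁅ y ⁆ ⊆ p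
⁅x⁆∪⁅y⁆⊆p x∈p y∈p = p⊆q⇒x∈q⇒p∪⁅x⁆⊆q (x∈p⇒⁅x⁆⊆p x∈p) y∈p

x,y∈p⇒2≤∣p∣ : x ∈ p → y ∈ p → x ≢ y → 2 ≤ ∣ p ∣
x,y∈p⇒2≤∣p∣ x∈p y∈p x≢y = subst (_≤ _) (∣⁅x⁆∪⁅y⁆∣≡2 x≢y) (p⊆q⇒∣p∣≤∣q∣ (⁅x⁆∪⁅y⁆⊆p x∈p y∈p))

p⊆q⇒∣q∣≤∣p∣⇒p≡q : p ⊆ q → ∣ q ∣ ≤ ∣ p ∣ → p ≡ q
p⊆q⇒∣q∣≤∣p∣⇒p≡q {p = p} {q} p⊆q ∣q∣≤∣p∣ = ⊆-antisym p⊆q q⊆p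
  where
  q⊆p : q ⊆ p
  q⊆p {x} x∈q with x ∈? p
  ... | yes x∈p = x∈p
  ... | no x∉p = ⊥-elim (<⇒≱ (p⊂q⇒∣p∣<∣q∣ (p⊆q , x , x∈q , x∉p)) ∣q∣≤∣p∣)

p⊆q⇒∣q∣≡1+∣p∣⇒q≡p∪⁅z⁆ : p ⊆ q → ∣ q ∣ ≡ suc ∣ p ∣ → ∃ λ z → z ∉ p × q ≡ p ∪ ⁅ z ⁆
p⊆q⇒∣q∣≡1+∣p∣⇒q≡p∪⁅z⁆ {p = p} {q} p⊆q ∣q∣≡1+∣p∣
  with any? (λ z → (z ∈? q) ×-dec ¬? (z ∈? p))
... | yes (z , z∈q , z∉p) = z , z∉p , sym (p⊆q⇒∣q∣≤∣p∣⇒p≡q (p⊆q⇒x∈q⇒p∪⁅x⁆⊆q p⊆q z∈q) ∣q∣≤∣p∪⁅z⁆∣)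
  where
  ∣q∣≤∣p∪⁅z⁆∣ : ∣ q ∣ ≤ ∣ p ∪ ⁅ z ⁆ ∣
  ∣q∣≤∣p∪⁅z⁆∣ = ≤-reflexive (trans ∣q∣≡1+∣p∣ (sym (x∉p⇒∣p∪⁅x⁆∣≡1+∣p∣ z∉p)))
... | no ∄z = ⊥-elim (≤⇒≯ (p⊆q⇒∣p∣≤∣q∣ q⊆p) (≤-reflexive (sym ∣q∣≡1+∣p∣)))
  where
  q⊆p : q ⊆ p
  q⊆p {z} z∈q with z ∈? p
  ... | yes z∈p = z∈p
  ... | no z∉p = ⊥-elim (∄z (z , z∈q , z∉p))

0<∣p∣⇒Nonempty : 0 < ∣ p ∣ → Nonempty p
0<∣p∣⇒Nonempty {n} {p} 0<∣p∣ with nonempty? p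
... | yes ne = ne
... | no empty = ⊥-elim (<-irrefl (sym (trans (cong ∣_∣ (Empty-unique empty)) (∣⊥∣≡0 n))) 0<∣p∣)

x∉q⇒[p∪⁅x⁆]∩q≡p∩q : x ∉ q → (p ∪ ⁅ x ⁆) ∩ q ≡ p ∩ q
x∉q⇒[p∪⁅x⁆]∩q≡p∩q {x = x} {q} {p} x∉q = begin
  (p ∪ ⁅ x ⁆) ∩ q          ≡⟨ ∩-distribʳ-∪ q p ⁅ x ⁆ ⟩
  (p ∩ q) ∪ (⁅ x ⁆ ∩ q)    ≡⟨ cong ((p ∩ q) ∪_) ⁅x⁆∩q≡⊥ ⟩
  (p ∩ q) ∪ ⊥              ≡⟨ ∪-identityʳ (p ∩ q) ⟩
  p ∩ q                    ∎
  where
  open ≡-Reasoning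
  ⁅x⁆∩q≡⊥ : ⁅ x ⁆ ∩ q ≡ ⊥
  ⁅x⁆∩q≡⊥ = ∩-≡⊥ λ y∈⁅x⁆ → subst (_∉ q) (sym (x∈⁅y⁆⇒x≡y x y∈⁅x⁆)) x∉q

∣∩∣≡1 : (∀ {z} → z ∈ p → z ∈ q → z ≡ x) → x ∈ p → x ∈ q → ∣ p ∩ q ∣ ≡ 1
∣∩∣≡1 {p = p} {q} {x} only-x x∈p x∈q = ≤-antisym
  (≤-trans (p⊆q⇒∣p∣≤∣q∣ ∩⊆⁅x⁆) (≤-reflexive (∣⁅x⁆∣≡1 x)))
  (x∈p⇒0<∣p∣ (x∈p∩q⁺ (x∈p , x∈q)))
  where
  ∩⊆⁅x⁆ : p ∩ q ⊆ ⁅ x ⁆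
  ∩⊆⁅x⁆ z∈ = let z∈p , z∈q = x∈p∩q⁻ p q z∈ in subst (_∈ ⁅ x ⁆) (sym (only-x z∈p z∈q)) (x∈⁅x⁆ x)

x∈p─q⇒x∉q : (p q : Subset n) → x ∈ p ─ q → x ∉ q
x∈p─q⇒x∉q (_ ∷ p) (true ∷ q) () here
x∈p─q⇒x∉q (_ ∷ p) (_ ∷ q) (there x∈p─q) (there x∈q) = x∈p─q⇒x∉q p q x∈p─q x∈q


-- Edges through a pair of vertices

one-point-extensions-bound : {p w : Subset n} (L : List (Subset n)) → Unique L →
  All (p ⊆_) L → All (λ e → ∣ e ∣ ≡ suc ∣ p ∣) L → All (_⊆ w) L → p ⊆ w → length L + ∣ p ∣ ≤ ∣ w ∣
one-point-extensions-bound [] _ _ _ _ p⊆w = p⊆q⇒∣p∣≤∣q∣ p⊆w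
one-point-extensions-bound {n} {p} {w} (e ∷ L) (e∉L ∷ uL) (p⊆e ∷ p⊆L) (∣e∣ ∷ ∣L∣) (e⊆w ∷ L⊆w) p⊆w
  with p⊆q⇒∣q∣≡1+∣p∣⇒q≡p∪⁅z⁆ p⊆e ∣e∣
... | z , z∉p , e≡p∪⁅z⁆ =
  ≤-trans (s≤s (one-point-extensions-bound L uL p⊆L ∣L∣ (avoid-z e∉L p⊆L ∣L∣ L⊆w)
                  (λ x∈p → x∈p∧x≢y⇒x∈p-y (p⊆w x∈p) (λ { refl → z∉p x∈p }))))
          (x∈p⇒∣p-x∣<∣p∣ (e⊆w z∈e))
  where
  z∈e : z ∈ e
  z∈e = subst (z ∈_) (sym e≡p∪⁅z⁆) (x∈p∪q⁺ (inj₂ (x∈⁅x⁆ z)))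
  avoid-z : ∀ {L} → All (e ≢_) L → All (p ⊆_) L → All (λ e → ∣ e ∣ ≡ suc ∣ p ∣) L → All (_⊆ w) L →
            All (_⊆ w - z) L
  avoid-z [] [] [] [] = []
  avoid-z (e≢e′ ∷ ≢s) (p⊆e′ ∷ p⊆s) (∣e′∣ ∷ ∣s∣) (e′⊆w ∷ ⊆w) = e′⊆w-z ∷ avoid-z ≢s p⊆s ∣s∣ ⊆w
    where
    e′⊆w-z : _ ⊆ w - z
    e′⊆w-z x∈e′ = x∈p∧x≢y⇒x∈p-y (e′⊆w x∈e′) λ where
      refl → e≢e′ (trans e≡p∪⁅z⁆ (p⊆q⇒∣q∣≤∣p∣⇒p≡q (p⊆q⇒x∈q⇒p∪⁅x⁆⊆q p⊆e′ x∈e′)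
                                      (≤-reflexive (trans ∣e′∣ (sym (x∉p⇒∣p∪⁅x⁆∣≡1+∣p∣ z∉p))))))

module _ (E : List (Subset n)) (uE : Unique E) (∣E∣≡3 : All (λ e → ∣ e ∣ ≡ 3) E) {x y : Fin n} where

  private
    through : List (Subset n)
    through = filter (λ e → (x ∈? e) ×-dec (y ∈? e)) E

    through⊆E : All (_∈ₗ E) through
    through⊆E = All.tabulate (λ e∈ → proj₁ (∈-filter⁻ (λ e → (x ∈? e) ×-dec (y ∈? e)) {xs = E} e∈))

    pair⊆through : All (⁅ x ⁆ ∪ ⁅ y ⁆ ⊆_) through
    pair⊆through = All.map (λ (x∈e , y∈e) → ⁅x⁆∪⁅y⁆⊆p x∈e y∈e) (all-filter _ E)

    ∣through∣≡1+∣pair∣ : x ≢ y → All (λ e → ∣ e ∣ ≡ suc ∣ ⁅ x ⁆ ∪ ⁅ y ⁆ ∣) through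
    ∣through∣≡1+∣pair∣ x≢y = All.map (λ ∣e∣ → trans ∣e∣ (sym (cong suc (∣⁅x⁆∪⁅y⁆∣≡2 x≢y)))) (AllP.filter⁺ _ ∣E∣≡3)

  edge-through-pair-leaving : {w : Subset n} → x ≢ y → ⁅ x ⁆ ∪ ⁅ y ⁆ ⊆ w → ∣ w ∣ < codeg E x y + 2 →
    ∃ λ z → z ∉ w × (⁅ x ⁆ ∪ ⁅ y ⁆) ∪ ⁅ z ⁆ ∈ₗ E
  edge-through-pair-leaving {w} x≢y pair⊆w ∣w∣<codeg with all? (_⊆? w) through
  ... | yes through⊆w = ⊥-elim (<⇒≱ ∣w∣<codeg
          (subst (λ s → length through + s ≤ ∣ w ∣) (∣⁅x⁆∪⁅y⁆∣≡2 x≢y)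
            (one-point-extensions-bound through (filter⁺ _ uE) pair⊆through (∣through∣≡1+∣pair∣ x≢y)
              through⊆w pair⊆w)))
  ... | no ¬through⊆w with find (¬All⇒Any¬ (_⊆? w) through ¬through⊆w)
  ...   | e , e∈ , e⊈w
    with p⊆q⇒∣q∣≡1+∣p∣⇒q≡p∪⁅z⁆ (All.lookup pair⊆through e∈) (All.lookup (∣through∣≡1+∣pair∣ x≢y) e∈)
  ...   | z , _ , e≡pair∪⁅z⁆ =
    z , (λ z∈w → e⊈w (subst (_⊆ w) (sym e≡pair∪⁅z⁆) (p⊆q⇒x∈q⇒p∪⁅x⁆⊆q pair⊆w z∈w)))
      , subst (_∈ₗ E) e≡pair∪⁅z⁆ (All.lookup through⊆E e∈)

-- Sequences of sets

infixl 5 _[_]≔_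

_[_]≔_ : (ℕ → A) → ℕ → A → ℕ → A
(c [ m ]≔ a) j with j ≟ m
... | yes _ = a
... | no _ = c j

[]≔-updates : (c : ℕ → A) (m : ℕ) {a : A} → (c [ m ]≔ a) m ≡ a
[]≔-updates c m with m ≟ m
... | yes _ = refl
... | no m≢m = contradiction refl m≢m

[]≔-minimal : (c : ℕ → A) {m j : ℕ} {a : A} → j ≢ m → (c [ m ]≔ a) j ≡ c j
[]≔-minimal c {m} {j} j≢m with j ≟ m
... | yes j≡m = contradiction j≡m j≢m
... | no _ = refl

<-suc-cases : {P : ℕ → Set} → (∀ j → j < m → P j) → P m → ∀ j → j < suc m → P j
<-suc-cases below at j j<1+m with m≤n⇒m<n∨m≡n (≤-pred j<1+m)
... | inj₁ j<m = below j j<m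
... | inj₂ refl = at

unionBelow : (ℕ → Subset n) → ℕ → Subset n
unionBelow c zero = ⊥
unionBelow c (suc m) = unionBelow c m ∪ c m

sizeSumBelow : (ℕ → Subset n) → ℕ → ℕ
sizeSumBelow c zero = 0
sizeSumBelow c (suc m) = sizeSumBelow c m + ∣ c m ∣

c⊆unionBelow : (c : ℕ → Subset n) {j m : ℕ} → j < m → c j ⊆ unionBelow c m
c⊆unionBelow c {j} {suc m} (s≤s j≤m) with m≤n⇒m<n∨m≡n j≤m
... | inj₁ j<m = λ x∈ → x∈p∪q⁺ (inj₁ (c⊆unionBelow c j<m x∈))
... | inj₂ refl = λ x∈ → x∈p∪q⁺ (inj₂ x∈)

∈-unionBelow⁻ : (c : ℕ → Subset n) (m : ℕ) → x ∈ unionBelow c m → ∃ λ j → j < m × x ∈ c j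
∈-unionBelow⁻ c zero x∈ = contradiction x∈ ∉⊥
∈-unionBelow⁻ c (suc m) x∈ with x∈p∪q⁻ (unionBelow c m) (c m) x∈
... | inj₁ x∈U = let j , j<m , x∈c = ∈-unionBelow⁻ c m x∈U in j , m<n⇒m<1+n j<m , x∈c
... | inj₂ x∈c = m , ≤-refl , x∈c

private
  +-≤-combine : ∀ {a b c d k m} → a + k ≤ b + c → b + m ≤ d → a + (k + m) ≤ d + c
  +-≤-combine {a} {b} {c} {d} {k} {m} a+k≤b+c b+m≤d = begin
    a + (k + m) ≡⟨ +-assoc a k m ⟨
    a + k + m   ≤⟨ +-monoˡ-≤ m a+k≤b+c ⟩
    b + c + m   ≡⟨ +-assoc b c m ⟩
    b + (c + m) ≡⟨ cong (b +_) (+-comm c m) ⟩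
    b + (m + c) ≡⟨ +-assoc b m c ⟨
    b + m + c   ≤⟨ +-monoˡ-≤ c b+m≤d ⟩
    d + c       ∎
    where open ≤-Reasoning

unionBelow-linked : (c : ℕ → Subset n) (m : ℕ) → (∀ j → j < m → Nonempty (c j ∩ c (suc j))) →
  ∣ unionBelow c (suc m) ∣ + m ≤ sizeSumBelow c (suc m)
unionBelow-linked c zero _ = ≤-reflexive (begin
  ∣ ⊥ ∪ c 0 ∣ + 0 ≡⟨ +-identityʳ _ ⟩
  ∣ ⊥ ∪ c 0 ∣     ≡⟨ cong ∣_∣ (∪-identityˡ (c 0)) ⟩
  ∣ c 0 ∣         ∎)
  where open ≡-Reasoning
unionBelow-linked c (suc m) linked =
  +-≤-combine {k = 1} (k≤∣p∩q∣⇒∣p∪q∣+k≤∣p∣+∣q∣ (unionBelow c (suc m)) (c (suc m)) meets) (unionBelow-linked c m λ j j<m → linked j (m<n⇒m<1+n j<m))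
  where
  meets : 1 ≤ ∣ unionBelow c (suc m) ∩ c (suc m) ∣
  meets = let x , x∈ = linked m ≤-refl ; x∈c , x∈c′ = x∈p∩q⁻ (c m) _ x∈ in
    x∈p⇒0<∣p∣ (x∈p∩q⁺ (c⊆unionBelow c ≤-refl x∈c , x∈c′))

unionBelow-cyclic : (c : ℕ → Subset n) (m : ℕ) → (∀ j → j < m → Nonempty (c j ∩ c (suc j))) →
  x ∈ c 0 → x ∈ c (suc m) → y ∈ c m → y ∈ c (suc m) → x ≢ y →
  ∣ unionBelow c (2 + m) ∣ + (2 + m) ≤ sizeSumBelow c (2 + m)
unionBelow-cyclic c m linked x∈first x∈last y∈c y∈last x≢y = +-≤-combine {k = 2}
  (k≤∣p∩q∣⇒∣p∪q∣+k≤∣p∣+∣q∣ (unionBelow c (suc m)) (c (suc m)) (x,y∈p⇒2≤∣p∣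
    (x∈p∩q⁺ (c⊆unionBelow c (s≤s z≤n) x∈first , x∈last))
    (x∈p∩q⁺ (c⊆unionBelow c ≤-refl y∈c , y∈last)) x≢y))
  (unionBelow-linked c m linked)

sizeSumBelow≤ : (c : ℕ → Subset n) (m : ℕ) {b : ℕ} → (∀ j → j < m → ∣ c j ∣ ≤ b) → sizeSumBelow c m ≤ m * b
sizeSumBelow≤ c zero _ = z≤n
sizeSumBelow≤ c (suc m) {b} bounded =
  ≤-trans (+-mono-≤ (sizeSumBelow≤ c m λ j j<m → bounded j (m<n⇒m<1+n j<m)) (bounded m ≤-refl))
          (≤-reflexive (+-comm (m * b) b))

sizeSumBelow< : (c : ℕ → Subset n) (m : ℕ) {b i : ℕ} → (∀ j → j < m → ∣ c j ∣ ≤ b) →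
  i < m → ∣ c i ∣ < b → sizeSumBelow c m < m * b
sizeSumBelow< c (suc m) {b} bounded i<1+m ∣ci∣<b = ≤-trans lt (≤-reflexive (+-comm (m * b) b))
  where
  bounded′ : ∀ j → j < m → ∣ c j ∣ ≤ b
  bounded′ j j<m = bounded j (m<n⇒m<1+n j<m)
  lt : sizeSumBelow c (suc m) < m * b + b
  lt with m≤n⇒m<n∨m≡n (≤-pred i<1+m)
  ... | inj₁ i<m = +-mono-≤ (sizeSumBelow< c m bounded′ i<m ∣ci∣<b) (bounded m ≤-refl)
  ... | inj₂ refl = ≤-trans (≤-reflexive (sym (+-suc _ _))) (+-mono-≤ (sizeSumBelow≤ c m bounded′) ∣ci∣<b)

-- Loose-cycle intersection patterns

-- CycAdj on ℕ-indices: CycAdj {l} i j unfolds to Adj l (toℕ i) (toℕ j).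
Adj : ℕ → ℕ → ℕ → Set
Adj l a b = b ≡ suc a ⊎ a ≡ suc b ⊎ (a ≡ 0 × suc b ≡ l) ⊎ (b ≡ 0 × suc a ≡ l)

Adj-sym : ∀ {l a b} → Adj l a b → Adj l b a
Adj-sym (inj₁ p) = inj₂ (inj₁ p)
Adj-sym (inj₂ (inj₁ p)) = inj₁ p
Adj-sym (inj₂ (inj₂ (inj₁ p))) = inj₂ (inj₂ (inj₂ p))
Adj-sym (inj₂ (inj₂ (inj₂ p))) = inj₂ (inj₂ (inj₁ p))

Adj-ordered : ∀ {l a b} → a < b → Adj l a b → b ≡ suc a ⊎ (a ≡ 0 × suc b ≡ l)
Adj-ordered a<b (inj₁ b≡1+a) = inj₁ b≡1+a
Adj-ordered a<b (inj₂ (inj₁ refl)) = contradiction a<b (<-asym (n<1+n _))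
Adj-ordered a<b (inj₂ (inj₂ (inj₁ first-last))) = inj₂ first-last
Adj-ordered a<b (inj₂ (inj₂ (inj₂ (refl , _)))) = contradiction a<b λ ()

MeetLoosely : ℕ → ℕ → ℕ → Subset n → Subset n → Set
MeetLoosely l a b p q = (Adj l a b → ∣ p ∩ q ∣ ≡ 1) × (¬ Adj l a b → p ∩ q ≡ ⊥)

MeetLoosely-sym : ∀ {l a b} {p q : Subset n} → MeetLoosely l a b p q → MeetLoosely l b a q p
MeetLoosely-sym {p = p} {q} (adj , ¬adj) =
  (λ ba → trans (cong ∣_∣ (∩-comm q p)) (adj (Adj-sym ba))) ,
  (λ ¬ba → trans (∩-comm q p) (¬adj (λ ab → ¬ba (Adj-sym ab))))

LooseBelow : ℕ → (ℕ → Subset n) → ℕ → Set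
LooseBelow l c m = ∀ a b → a < b → b < m → MeetLoosely l a b (c a) (c b)

LooseBelow-snoc : ∀ {l} {c : ℕ → Subset n} {m e} → LooseBelow l c m →
  (∀ a → a < m → MeetLoosely l a m (c a) e) → LooseBelow l (c [ m ]≔ e) (suc m)
LooseBelow-snoc {l = l} {c = c} {m} {e} loose meet a b a<b b<1+m
  rewrite []≔-minimal c {a = e} (<⇒≢ (<-≤-trans a<b (≤-pred b<1+m)))
  with m≤n⇒m<n∨m≡n (≤-pred b<1+m)
... | inj₁ b<m rewrite []≔-minimal c {a = e} (<⇒≢ b<m) = loose a b a<b b<m
... | inj₂ refl rewrite []≔-updates c b {e} = meet a a<b

LooseBelow-linked : ∀ {l} {c : ℕ → Subset n} {m} → LooseBelow l c m →
  ∀ j → suc j < m → Nonempty (c j ∩ c (suc j))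
LooseBelow-linked loose j 1+j<m =
  0<∣p∣⇒Nonempty (≤-reflexive (sym (proj₁ (loose j (suc j) ≤-refl 1+j<m) (inj₁ refl))))

LooseBelow-cong : ∀ {l} {c c′ : ℕ → Subset n} {m} →
  (∀ a b → a < b → b < m → c′ a ∩ c′ b ≡ c a ∩ c b) → LooseBelow l c m → LooseBelow l c′ m
LooseBelow-cong same loose a b a<b b<m rewrite same a b a<b b<m = loose a b a<b b<m

LooseBelow⇒IsLooseCycle : ∀ {l} {G : Subset n → Set} {c : ℕ → Subset n} → LooseBelow l c l →
  (∀ a → a < l → G (c a)) → IsLooseCycle G l (λ i → c (toℕ i))
LooseBelow⇒IsLooseCycle loose edges =
  (λ i → edges (toℕ i) (toℕ<n i)) , λ i j i≢j → meet i j i≢j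
  where
  meet : ∀ i j → i ≢ j → MeetLoosely _ (toℕ i) (toℕ j) _ _
  meet i j i≢j with <-cmp (toℕ i) (toℕ j)
  ... | tri< i<j _ _ = loose _ _ i<j (toℕ<n j)
  ... | tri≈ _ i≡j _ = contradiction (toℕ-injective i≡j) i≢j
  ... | tri> _ _ j<i = MeetLoosely-sym (loose _ _ j<i (toℕ<n i))

LooseBelow-add-fresh : ∀ {l} {c : ℕ → Subset n} {m i z} → (∀ j → j < m → j ≢ i → z ∉ c j) →
  LooseBelow l c m → LooseBelow l (c [ i ]≔ c i ∪ ⁅ z ⁆) m
LooseBelow-add-fresh {c = c} {m} {i} {z} fresh = LooseBelow-cong same
  where
  c′ = c [ i ]≔ c i ∪ ⁅ z ⁆
  same : ∀ a b → a < b → b < m → c′ a ∩ c′ b ≡ c a ∩ c b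
  same a b a<b b<m with a ≟ i | b ≟ i
  ... | yes refl | yes refl = contradiction refl (<⇒≢ a<b)
  ... | yes refl | no b≢a = x∉q⇒[p∪⁅x⁆]∩q≡p∩q (fresh b b<m b≢a)
  ... | no a≢b | yes refl = begin
    c a ∩ (c b ∪ ⁅ z ⁆) ≡⟨ ∩-comm (c a) _ ⟩
    (c b ∪ ⁅ z ⁆) ∩ c a ≡⟨ x∉q⇒[p∪⁅x⁆]∩q≡p∩q (fresh a (<-trans a<b b<m) a≢b) ⟩
    c b ∩ c a           ≡⟨ ∩-comm (c b) (c a) ⟩
    c a ∩ c b           ∎
    where open ≡-Reasoning
  ... | no _ | no _ = refl

-- Replacing heavy pairs

HeavyPair : ∀ {n} → ℕ → List (Subset n) → Subset n → Set
HeavyPair l E e = ∃ λ x → ∃ λ y → Heavy l E x y × e ≡ ⁅ x ⁆ ∪ ⁅ y ⁆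

EdgeOrHeavyPair : ∀ {n} → ℕ → List (Subset n) → Subset n → Set
EdgeOrHeavyPair l E e = e ∈ₗ E ⊎ HeavyPair l E e

PlusStar⇒EdgeOrHeavyPair : ∀ {n l} {E : List (Subset n)} {e} → PlusStar l E e → EdgeOrHeavyPair l E e
PlusStar⇒EdgeOrHeavyPair (inj₁ e∈E) = inj₁ e∈E
PlusStar⇒EdgeOrHeavyPair (inj₂ (inj₁ (e∈E , _))) = inj₁ e∈E
PlusStar⇒EdgeOrHeavyPair (inj₂ (inj₂ heavy-pair)) = inj₂ heavy-pair

∣EdgeOrHeavyPair∣≤3 : ∀ {n l} {E : List (Subset n)} {e} → All (λ e → ∣ e ∣ ≡ 3) E → EdgeOrHeavyPair l E e → ∣ e ∣ ≤ 3
∣EdgeOrHeavyPair∣≤3 ∣E∣≡3 (inj₁ e∈E) = ≤-reflexive (All.lookup ∣E∣≡3 e∈E)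
∣EdgeOrHeavyPair∣≤3 _ (inj₂ (_ , _ , (x≢y , _) , refl)) = ≤-trans (≤-reflexive (∣⁅x⁆∪⁅y⁆∣≡2 x≢y)) (n≤1+n 2)

private
  w+l<3l⇒2l∸2≤d⇒w<d+2 : ∀ {w l d} → w + l < l * 3 → 2 * l ∸ 2 ≤ d → w < d + 2
  w+l<3l⇒2l∸2≤d⇒w<d+2 {w} {l} {d} w+l<3l 2l∸2≤d = begin-strict
    w             <⟨ +-cancelʳ-< l w (2 * l) (<-≤-trans w+l<3l (≤-reflexive (3l≡2l+l l))) ⟩
    2 * l         ≤⟨ m≤n+m∸n (2 * l) 2 ⟩
    2 + (2 * l ∸ 2) ≡⟨ +-comm 2 _ ⟩
    2 * l ∸ 2 + 2 ≤⟨ +-monoˡ-≤ 2 2l∸2≤d ⟩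
    d + 2         ∎
    where
    open ≤-Reasoning
    3l≡2l+l : ∀ l → l * 3 ≡ 2 * l + l
    3l≡2l+l = solve-∀

module _ {n : ℕ} (E : List (Subset n)) (uE : Unique E) (∣E∣≡3 : All (λ e → ∣ e ∣ ≡ 3) E)
         (M : ℕ) {x y : Fin n} (x≢y : x ≢ y) where

  private
    l : ℕ
    l = suc (suc M)

  -- The distinct points x ∈ c 0 ∩ c (suc M) and y ∈ c M ∩ c (suc M) bound the cycle by 2l − 1
  -- vertices (unionBelow-cyclic); for l = 3 this does not follow from the intersection pattern.
  record Candidate (c : ℕ → Subset n) : Set where
    field
      loose  : LooseBelow l c l
      edges  : ∀ j → j < l → EdgeOrHeavyPair l E (c j)
      x∈head        : x ∈ c 0
      x∈last        : x ∈ c (suc M)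
      y∈penultimate : y ∈ c M
      y∈last        : y ∈ c (suc M)

  private
    module Replace {c : ℕ → Subset n} (cand : Candidate c) {i : ℕ} (i<l : i < l) {x′ y′ : Fin n}
                   (x′≢y′ : x′ ≢ y′) (heavy : 2 * l ∸ 2 ≤ codeg E x′ y′) (ci≡pair : c i ≡ ⁅ x′ ⁆ ∪ ⁅ y′ ⁆) where
      open Candidate cand

      W : Subset n
      W = unionBelow c l

      ∣W∣+l<3l : ∣ W ∣ + l < l * 3
      ∣W∣+l<3l = ≤-<-trans
        (unionBelow-cyclic c M (λ j j<M → LooseBelow-linked loose j (s≤s (m≤n⇒m≤1+n j<M)))
           x∈head x∈last y∈penultimate y∈last x≢y)
        (sizeSumBelow< c l (λ j j<l → ∣EdgeOrHeavyPair∣≤3 {l = l} ∣E∣≡3 (edges j j<l)) i<l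
           (≤-trans (≤-reflexive (cong suc (trans (cong ∣_∣ ci≡pair) (∣⁅x⁆∪⁅y⁆∣≡2 x′≢y′)))) ≤-refl))

      fresh : ∃ λ z → z ∉ W × (⁅ x′ ⁆ ∪ ⁅ y′ ⁆) ∪ ⁅ z ⁆ ∈ₗ E
      fresh = edge-through-pair-leaving E uE ∣E∣≡3 x′≢y′
        (subst (_⊆ W) ci≡pair (c⊆unionBelow c i<l)) (w+l<3l⇒2l∸2≤d⇒w<d+2 ∣W∣+l<3l heavy)

      z : Fin n
      z = proj₁ fresh

      z∉c : ∀ j → j < l → z ∉ c j
      z∉c j j<l z∈cj = proj₁ (proj₂ fresh) (c⊆unionBelow c j<l z∈cj)

      c′ : ℕ → Subset n
      c′ = c [ i ]≔ c i ∪ ⁅ z ⁆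

      c′i∈E : c′ i ∈ₗ E
      c′i∈E = subst (_∈ₗ E) (sym (trans ([]≔-updates c i) (cong (_∪ ⁅ z ⁆) ci≡pair))) (proj₂ (proj₂ fresh))

      c′-minimal : ∀ j → j ≢ i → c′ j ≡ c j
      c′-minimal j = []≔-minimal c

      c⊆c′ : ∀ j → c j ⊆ c′ j
      c⊆c′ j with i ≟ j
      ... | yes refl = subst (c i ⊆_) (sym ([]≔-updates c i)) (p⊆p∪q ⁅ z ⁆)
      ... | no i≢j = ⊆-reflexive (sym (c′-minimal j (≢-sym i≢j)))

      candidate : Candidate c′
      candidate = record
        { loose         = LooseBelow-add-fresh (λ j j<l _ → z∉c j j<l) loose
        ; edges         = edges′
        ; x∈head        = c⊆c′ 0 x∈head
        ; x∈last        = c⊆c′ (suc M) x∈last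
        ; y∈penultimate = c⊆c′ M y∈penultimate
        ; y∈last        = c⊆c′ (suc M) y∈last
        }
        where
        edges′ : ∀ j → j < l → EdgeOrHeavyPair l E (c′ j)
        edges′ j j<l with i ≟ j
        ... | yes refl = inj₁ c′i∈E
        ... | no i≢j rewrite c′-minimal j (≢-sym i≢j) = edges j j<l

  remove-heavy-pair : ∀ {c} → Candidate c → ∀ {i} → i < l → HeavyPair l E (c i) →
    ∃ λ c′ → Candidate c′ × c′ i ∈ₗ E × (∀ j → j ≢ i → c′ j ≡ c j)
  remove-heavy-pair cand i<l (_ , _ , (x′≢y′ , heavy) , ci≡pair) =
    c′ , candidate , c′i∈E , c′-minimal
    where open Replace cand i<l x′≢y′ heavy ci≡pair

  private
    sweep : ∀ {c} → Candidate c → ∀ m → m ≤ l → ∃ λ c′ → Candidate c′ × (∀ j → j < m → c′ j ∈ₗ E)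
    sweep cand zero _ = _ , cand , λ _ ()
    sweep cand (suc m) m<l with sweep cand m (<⇒≤ m<l)
    ... | c , cand′ , below∈E with Candidate.edges cand′ m m<l
    ...   | inj₁ cm∈E = c , cand′ , <-suc-cases below∈E cm∈E
    ...   | inj₂ heavy with remove-heavy-pair cand′ m<l heavy
    ...     | c″ , cand″ , c″m∈E , c″-minimal =
      c″ , cand″ , <-suc-cases (λ j j<m → subst (_∈ₗ E) (sym (c″-minimal j (<⇒≢ j<m))) (below∈E j j<m)) c″m∈E

  Candidate⇒HasLooseCycle : ∀ {c} → Candidate c → HasLooseCycle (edgesOf E) l
  Candidate⇒HasLooseCycle cand with sweep cand l ≤-refl
  ... | c , cand′ , all∈E = _ , LooseBelow⇒IsLooseCycle {G = edgesOf E} (Candidate.loose cand′) all∈E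

-- Closing the path into a cycle

-- f read as a sequence, with the junk value d from index k on
extend : ∀ {k} {A : Set} → A → (Fin k → A) → ℕ → A
extend {k} d f j with j <? k
... | yes j<k = f (fromℕ< j<k)
... | no _ = d

module ExtendLift {k} {A : Set} (d : A) (f : Fin k → A) where

  extend-lift : (P : ℕ → A → Set) → (∀ i → P (toℕ i) (f i)) → ∀ j → j < k → P j (extend d f j)
  extend-lift P Pf j j<k with j <? k
  ... | yes j<k′ = subst (λ t → P t (f (fromℕ< j<k′))) (toℕ-fromℕ< j<k′) (Pf (fromℕ< j<k′))
  ... | no j≮k = contradiction j<k j≮k

  extend-lift₂ : (R : ℕ → ℕ → A → A → Set) → (∀ i i′ → R (toℕ i) (toℕ i′) (f i) (f i′)) →
    ∀ j j′ → j < k → j′ < k → R j j′ (extend d f j) (extend d f j′)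
  extend-lift₂ R Rf j j′ j<k j′<k =
    extend-lift (λ t a → ∀ t′ → t′ < k → R t t′ a (extend d f t′))
      (λ i → extend-lift (λ t′ a′ → R (toℕ i) t′ (f i) a′) (Rf i)) j j<k j′ j′<k

private
  s+2≤w⇒w+k≤3[1+k]⇒s≤2[3+k]∸5 : ∀ {s w k} → s + 2 ≤ w → w + k ≤ suc k * 3 → s ≤ 2 * (3 + k) ∸ 5
  s+2≤w⇒w+k≤3[1+k]⇒s≤2[3+k]∸5 {s} {w} {k} s+2≤w w+k≤3[1+k] = begin
    s                 ≤⟨ +-cancelʳ-≤ (2 + k) s (2 * k + 1) (begin
      s + (2 + k)         ≡⟨ +-assoc s 2 k ⟨
      s + 2 + k           ≤⟨ +-monoˡ-≤ k s+2≤w ⟩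
      w + k               ≤⟨ w+k≤3[1+k] ⟩
      suc k * 3           ≡⟨ 3[1+k]≡ k ⟩
      2 * k + 1 + (2 + k) ∎) ⟩
    2 * k + 1           ≡⟨ m+n∸m≡n 5 _ ⟨
    5 + (2 * k + 1) ∸ 5 ≡⟨ cong (_∸ 5) (2[3+k]≡ k) ⟨
    2 * (3 + k) ∸ 5     ∎
    where
    open ≤-Reasoning
    3[1+k]≡ : ∀ k → suc k * 3 ≡ 2 * k + 1 + (2 + k)
    3[1+k]≡ = solve-∀
    2[3+k]≡ : ∀ k → 2 * (3 + k) ≡ 5 + (2 * k + 1)
    2[3+k]≡ = solve-∀

module ClosingPath {n k′ : ℕ} (E : List (Subset n)) (uE : Unique E) (∣E∣≡3 : All (λ e → ∣ e ∣ ≡ 3) E)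
  (Y : Subset n) {u v : Fin n} (u≢v : u ≢ v) (f : Fin (suc k′) → Subset n)
  (path : IsPath (Induced (PlusStar (3 + k′) E) (∁ Y)) (suc k′) f) (simple : IsSimple f) (joins : Joins f u v) where

  private
    l k : ℕ
    l = 3 + k′
    k = suc k′

  fℕ : ℕ → Subset n
  fℕ = extend ⊥ f

  open ExtendLift ⊥ f

  fℕ-edge : ∀ j → j < k → PlusStar l E (fℕ j) × fℕ j ⊆ ∁ Y
  fℕ-edge = extend-lift (λ _ e → PlusStar l E e × e ⊆ ∁ Y) (proj₁ path)

  fℕ-meet : ∀ a b → a < k → b < k → a < b →
    (b ≡ suc a → Nonempty (fℕ a ∩ fℕ b)) × (b ≢ suc a → fℕ a ∩ fℕ b ≡ ⊥)
  fℕ-meet = extend-lift₂ (λ a b p q → a < b → (b ≡ suc a → Nonempty (p ∩ q)) × (b ≢ suc a → p ∩ q ≡ ⊥))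
    (proj₂ (proj₂ path))

  fℕ-simple : ∀ a b → a < k → b < k → a ≢ b → ∣ fℕ a ∩ fℕ b ∣ ≤ 1
  fℕ-simple = extend-lift₂ (λ a b p q → a ≢ b → ∣ p ∩ q ∣ ≤ 1)
    (λ i i′ toℕi≢toℕi′ → simple i i′ (λ i≡i′ → toℕi≢toℕi′ (cong toℕ i≡i′)))

  u∈head : u ∈ fℕ 0
  u∈head = extend-lift (λ j e → j ≡ 0 → u ∈ e) (proj₁ joins) 0 (s≤s z≤n) refl

  u∉second : 1 < k → u ∉ fℕ 1
  u∉second 1<k = extend-lift (λ j e → j ≡ 1 → u ∉ e) (proj₁ (proj₂ joins)) 1 1<k refl

  v∈last : v ∈ fℕ k′
  v∈last = extend-lift (λ j e → suc j ≡ k → v ∈ e) (proj₁ (proj₂ (proj₂ joins))) k′ ≤-refl refl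

  v∉penultimate : ∀ j → suc (suc j) ≡ k → v ∉ fℕ j
  v∉penultimate j 2+j≡k = extend-lift (λ j e → suc (suc j) ≡ k → v ∉ e) (proj₂ (proj₂ (proj₂ joins)))
    j (≤-trans (n≤1+n _) (≤-reflexive 2+j≡k)) 2+j≡k

  u-only-in-head : ∀ a → a < k → u ∈ fℕ a → a ≡ 0
  u-only-in-head zero _ _ = refl
  u-only-in-head (suc zero) 1<k u∈ = contradiction u∈ (u∉second 1<k)
  u-only-in-head (suc (suc a)) a<k u∈ =
    contradiction u∈ (∩≡⊥⇒x∈p⇒x∉q (proj₂ (fℕ-meet 0 (2 + a) (s≤s z≤n) a<k (s≤s z≤n)) λ ()) u∈head)

  v-only-in-last : ∀ a → a < k → v ∈ fℕ a → a ≡ k′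
  v-only-in-last a a<k v∈ with m≤n⇒m<n∨m≡n (≤-pred a<k)
  ... | inj₂ a≡k′ = a≡k′
  ... | inj₁ a<k′ with k′ ≟ suc a
  ...   | yes refl = contradiction v∈ (v∉penultimate a refl)
  ...   | no k′≢1+a = contradiction v∈last (∩≡⊥⇒x∈p⇒x∉q (proj₂ (fℕ-meet a k′ a<k ≤-refl a<k′) k′≢1+a) v∈)

  fℕ-loose : LooseBelow l fℕ k
  fℕ-loose a b a<b b<k = adjacent , non-adjacent
    where
    adjacent : Adj l a b → ∣ fℕ a ∩ fℕ b ∣ ≡ 1
    adjacent adj with Adj-ordered a<b adj
    ... | inj₁ b≡1+a = let _ , w∈ = proj₁ (fℕ-meet a b (<-trans a<b b<k) b<k a<b) b≡1+a in
      ≤-antisym (fℕ-simple a b (<-trans a<b b<k) b<k (<⇒≢ a<b)) (x∈p⇒0<∣p∣ w∈)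
    ... | inj₂ (_ , 1+b≡l) = contradiction 1+b≡l (<⇒≢ (<-trans (s≤s b<k) (n<1+n _)))
    non-adjacent : ¬ Adj l a b → fℕ a ∩ fℕ b ≡ ⊥
    non-adjacent ¬adj = proj₂ (fℕ-meet a b (<-trans a<b b<k) b<k a<b) (λ b≡1+a → ¬adj (inj₁ b≡1+a))

  fℕ-EdgeOrHeavyPair : ∀ j → j < k → EdgeOrHeavyPair l E (fℕ j)
  fℕ-EdgeOrHeavyPair j j<k = PlusStar⇒EdgeOrHeavyPair {l = l} (proj₁ (fℕ-edge j j<k))

  U : Subset n
  U = unionBelow fℕ k

  interior : Subset n
  interior = U ─ (⁅ u ⁆ ∪ ⁅ v ⁆)

  interior-avoids : ∀ x → x ∈ interior → x ≢ u × x ≢ v × x ∉ Y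
  interior-avoids x x∈ =
    (λ { refl → ∉uv (x∈p∪q⁺ (inj₁ (x∈⁅x⁆ u))) }) , (λ { refl → ∉uv (x∈p∪q⁺ (inj₂ (x∈⁅x⁆ v))) }) , ∉Y
    where
    ∉uv : x ∉ ⁅ u ⁆ ∪ ⁅ v ⁆
    ∉uv = x∈p─q⇒x∉q U _ x∈
    ∉Y : x ∉ Y
    ∉Y = let j , j<k , x∈fℕj = ∈-unionBelow⁻ fℕ k (p─q⊆p U _ x∈) in
      x∈∁p⇒x∉p (proj₂ (fℕ-edge j j<k) x∈fℕj)

  U─interior : ∀ {x} → x ∈ U → x ∉ interior → x ≡ u ⊎ x ≡ v
  U─interior {x} x∈U x∉ with x ∈? (⁅ u ⁆ ∪ ⁅ v ⁆)
  ... | no ∉uv = contradiction (x∈p∧x∉q⇒x∈p─q x∈U ∉uv) x∉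
  ... | yes ∈uv with x∈p∪q⁻ ⁅ u ⁆ ⁅ v ⁆ ∈uv
  ...   | inj₁ x∈⁅u⁆ = inj₁ (x∈⁅y⁆⇒x≡y u x∈⁅u⁆)
  ...   | inj₂ x∈⁅v⁆ = inj₂ (x∈⁅y⁆⇒x≡y v x∈⁅v⁆)

  ∣interior∣≤2l∸5 : ∣ interior ∣ ≤ 2 * l ∸ 5
  ∣interior∣≤2l∸5 = s+2≤w⇒w+k≤3[1+k]⇒s≤2[3+k]∸5 (begin
    ∣ interior ∣ + 2                 ≤⟨ +-monoʳ-≤ ∣ interior ∣ (x,y∈p⇒2≤∣p∣ (u∈U∩uv) (v∈U∩uv) u≢v) ⟩
    ∣ interior ∣ + ∣ U ∩ (⁅ u ⁆ ∪ ⁅ v ⁆) ∣ ≡⟨ ∣p─q∣+∣p∩q∣≡∣p∣ U _ ⟩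
    ∣ U ∣                           ∎)
    (≤-trans (unionBelow-linked fℕ k′ λ j j<k′ → LooseBelow-linked fℕ-loose j (s≤s j<k′))
             (sizeSumBelow≤ fℕ k λ j j<k → ∣EdgeOrHeavyPair∣≤3 {l = l} ∣E∣≡3 (fℕ-EdgeOrHeavyPair j j<k)))
    where
    open ≤-Reasoning
    u∈U∩uv : u ∈ U ∩ (⁅ u ⁆ ∪ ⁅ v ⁆)
    u∈U∩uv = x∈p∩q⁺ (c⊆unionBelow fℕ {0} {k} (s≤s z≤n) u∈head , x∈p∪q⁺ (inj₁ (x∈⁅x⁆ u)))
    v∈U∩uv : v ∈ U ∩ (⁅ u ⁆ ∪ ⁅ v ⁆)
    v∈U∩uv = x∈p∩q⁺ (c⊆unionBelow fℕ {k′} {k} ≤-refl v∈last , x∈p∪q⁺ (inj₂ (x∈⁅x⁆ v)))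

  module _ (g : Fin 2 → Subset n) (g-path : IsPath (edgesOf E) 2 g) (g-simple : IsSimple g)
           (g-joins : Joins g u v) (g-avoids : ∀ i x → x ∈ g i → x ∉ interior) where

    private
      g₀ g₁ : Subset n
      g₀ = g zero
      g₁ = g (suc zero)

      u∈g₀ : u ∈ g₀
      u∈g₀ = proj₁ g-joins zero refl
      u∉g₁ : u ∉ g₁
      u∉g₁ = proj₁ (proj₂ g-joins) (suc zero) refl
      v∈g₁ : v ∈ g₁
      v∈g₁ = proj₁ (proj₂ (proj₂ g-joins)) (suc zero) refl
      v∉g₀ : v ∉ g₀
      v∉g₀ = proj₂ (proj₂ (proj₂ g-joins)) zero refl

      g₀∩g₁ : Nonempty (g₀ ∩ g₁)
      g₀∩g₁ = proj₁ (proj₂ (proj₂ g-path) zero (suc zero) (s≤s z≤n)) refl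

      ∣g₁∩g₀∣≡1 : ∣ g₁ ∩ g₀ ∣ ≡ 1
      ∣g₁∩g₀∣≡1 = ≤-antisym (g-simple (suc zero) zero λ ())
        (let w , w∈ = g₀∩g₁ in x∈p⇒0<∣p∣ (subst (_ ∈_) (∩-comm g₀ g₁) w∈))

      fℕ∩g₀ : ∀ {a w} → a < k → w ∈ fℕ a → w ∈ g₀ → w ≡ u
      fℕ∩g₀ a<k w∈fℕ w∈g₀ with U─interior (c⊆unionBelow fℕ a<k w∈fℕ) (g-avoids zero _ w∈g₀)
      ... | inj₁ w≡u = w≡u
      ... | inj₂ refl = contradiction w∈g₀ v∉g₀

      fℕ∩g₁ : ∀ {a w} → a < k → w ∈ fℕ a → w ∈ g₁ → w ≡ v
      fℕ∩g₁ a<k w∈fℕ w∈g₁ with U─interior (c⊆unionBelow fℕ a<k w∈fℕ) (g-avoids (suc zero) _ w∈g₁)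
      ... | inj₁ refl = contradiction w∈g₁ u∉g₁
      ... | inj₂ w≡v = w≡v

      meet-g₁ : ∀ a → a < k → MeetLoosely l a k (fℕ a) g₁
      meet-g₁ a a<k = adjacent , non-adjacent
        where
        adjacent : Adj l a k → ∣ fℕ a ∩ g₁ ∣ ≡ 1
        adjacent adj with Adj-ordered a<k adj
        ... | inj₁ refl = ∣∩∣≡1 (fℕ∩g₁ a<k) v∈last v∈g₁
        ... | inj₂ (_ , 1+k≡l) = contradiction 1+k≡l (<⇒≢ (n<1+n _))
        non-adjacent : ¬ Adj l a k → fℕ a ∩ g₁ ≡ ⊥
        non-adjacent ¬adj = ∩-≡⊥ λ w∈fℕ w∈g₁ → ¬adj (inj₁ (cong suc (sym
          (v-only-in-last a a<k (subst (_∈ fℕ a) (fℕ∩g₁ a<k w∈fℕ w∈g₁) w∈fℕ)))))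

      meet-g₀ : ∀ a → a < suc k → MeetLoosely l a (suc k) ((fℕ [ k ]≔ g₁) a) g₀
      meet-g₀ a a<1+k with m≤n⇒m<n∨m≡n (≤-pred a<1+k)
      ... | inj₂ refl rewrite []≔-updates fℕ a {g₁} =
        (λ _ → ∣g₁∩g₀∣≡1) , (λ ¬adj → contradiction (inj₁ refl) ¬adj)
      ... | inj₁ a<k rewrite []≔-minimal fℕ {a = g₁} (<⇒≢ a<k) = adjacent , non-adjacent
        where
        adjacent : Adj l a (suc k) → ∣ fℕ a ∩ g₀ ∣ ≡ 1
        adjacent adj with Adj-ordered (m<n⇒m<1+n a<k) adj
        ... | inj₁ refl = contradiction a<k (<-irrefl refl)
        ... | inj₂ (refl , _) = ∣∩∣≡1 (fℕ∩g₀ a<k) u∈head u∈g₀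
        non-adjacent : ¬ Adj l a (suc k) → fℕ a ∩ g₀ ≡ ⊥
        non-adjacent ¬adj = ∩-≡⊥ λ w∈fℕ w∈g₀ → ¬adj (inj₂ (inj₂ (inj₁
          (u-only-in-head a a<k (subst (_∈ fℕ a) (fℕ∩g₀ a<k w∈fℕ w∈g₀) w∈fℕ) , refl))))

      cycle : ℕ → Subset n
      cycle = fℕ [ k ]≔ g₁ [ suc k ]≔ g₀

      cycle-path : ∀ j → j < k → cycle j ≡ fℕ j
      cycle-path j j<k = trans ([]≔-minimal _ (<⇒≢ (m<n⇒m<1+n j<k))) ([]≔-minimal fℕ (<⇒≢ j<k))

      cycle-g₁ : cycle k ≡ g₁
      cycle-g₁ = trans ([]≔-minimal _ (<⇒≢ (n<1+n k))) ([]≔-updates fℕ k)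

      cycle-g₀ : cycle (suc k) ≡ g₀
      cycle-g₀ = []≔-updates _ (suc k)

      w : Fin n
      w = proj₁ g₀∩g₁

      w∈g₀ : w ∈ g₀
      w∈g₀ = proj₁ (x∈p∩q⁻ g₀ g₁ (proj₂ g₀∩g₁))

      w∈g₁ : w ∈ g₁
      w∈g₁ = proj₂ (x∈p∩q⁻ g₀ g₁ (proj₂ g₀∩g₁))

      u≢w : u ≢ w
      u≢w refl = u∉g₁ w∈g₁

      cycle-edges : ∀ j → j < l → EdgeOrHeavyPair l E (cycle j)
      cycle-edges = <-suc-cases
        (<-suc-cases (λ j j<k → subst (EdgeOrHeavyPair l E) (sym (cycle-path j j<k)) (fℕ-EdgeOrHeavyPair j j<k))
                     (subst (EdgeOrHeavyPair l E) (sym cycle-g₁) (inj₁ (proj₁ g-path (suc zero)))))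
        (subst (EdgeOrHeavyPair l E) (sym cycle-g₀) (inj₁ (proj₁ g-path zero)))

      candidate : Candidate E uE ∣E∣≡3 k u≢w cycle
      candidate = record
        { loose         = LooseBelow-snoc (LooseBelow-snoc fℕ-loose meet-g₁) meet-g₀
        ; edges         = cycle-edges
        ; x∈head        = subst (u ∈_) (sym (cycle-path 0 (s≤s z≤n))) u∈head
        ; x∈last        = subst (u ∈_) (sym cycle-g₀) u∈g₀
        ; y∈penultimate = subst (w ∈_) (sym cycle-g₁) w∈g₁
        ; y∈last        = subst (w ∈_) (sym cycle-g₀) w∈g₀
        }

    closing-cycle : HasLooseCycle (edgesOf E) l
    closing-cycle = Candidate⇒HasLooseCycle E uE ∣E∣≡3 k u≢w candidate

lemma4p2 : (n l : ℕ) → 3 ≤ l →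
    (E : List (Subset n)) → Unique E → All (λ e → ∣ e ∣ ≡ 3) E →
    ¬ HasLooseCycle (edgesOf E) l →
    (X Y : Subset n) → IsExtender l E X Y →
    (u v : Fin n) → u ∈ X → v ∈ X → u ≢ v →
    ¬ SimplePathJoining (Induced (PlusStar l E) (∁ Y)) (l ∸ 2) u v
lemma4p2 n (suc (suc (suc k′))) (s≤s (s≤s (s≤s z≤n))) E uE ∣E∣≡3 no-cycle X Y (_ , extends , _)
         u v u∈X v∈X u≢v (f , path , simple , joins) =
  let g , g-path , g-simple , g-joins , g-avoids =
        extends u v u∈X v∈X u≢v interior interior-avoids ∣interior∣≤2l∸5
  in no-cycle (closing-cycle g g-path g-simple g-joins g-avoids)
  where open ClosingPath E uE ∣E∣≡3 Y u≢v f path simple joins
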